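{- Let $L=\left(\frac{1+yx+yx^2}{(1+x)^2},\frac{x}{(1+x)^2}\right)$ and let $\mu_n(y)$ be the $(n,0)$ entry of $L^{ -1}$. Then for all $n\ge0$ the Hankel determinant satisfies $h_n(y):=\det\left(\mu_{i+j}(y)\right)_{0\le i,j\le n}=(1-y)^n$. -}

module Defs where

open import Level using (Level)
open import Data.Nat using (ℕ; zero; suc; _∸_; _≡ᵇ_)
open import Data.Bool using (if_then_else_)
open import Data.Fin using (Fin; toℕ; punchIn)
import Data.Fin as Fin
open import Algebra.Bundles using (CommutativeRing)

module _ {c ℓ : Level} (R : CommutativeRing c ℓ) where
  open CommutativeRing R

  sumTo : ℕ → (ℕ → Carrier) → Carrier
  sumTo zero    f = f 0
  sumTo (suc n) f = sumTo n f + f (suc n)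

  sumFin : (n : ℕ) → (Fin n → Carrier) → Carrier
  sumFin zero    f = 0#
  sumFin (suc n) f = f Fin.zero + sumFin n (λ i → f (Fin.suc i))

  sgn : ℕ → Carrier
  sgn zero    = 1#
  sgn (suc n) = - sgn n

  pow : Carrier → ℕ → Carrier
  pow x zero    = 1#
  pow x (suc n) = x * pow x n

  δ : ℕ → ℕ → Carrier
  δ m n = if m ≡ᵇ n then 1# else 0#

  det : (n : ℕ) → (Fin n → Fin n → Carrier) → Carrier
  det zero    A = 1#
  det (suc n) A =
    sumFin (suc n) (λ j → sgn (toℕ j) * (A Fin.zero j * det n (λ r s → A (Fin.suc r) (punchIn j s))))

  -- Formal power series over R: coefficient sequences ℕ → R.
  PS : Set c
  PS = ℕ → Carrier

  _⋆_ : PS → PS → PS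
  (a ⋆ b) n = sumTo n (λ i → a i * b (n ∸ i))

  oneS : PS
  oneS n = δ n 0

  X : PS
  X n = δ n 1

  powS : PS → ℕ → PS
  powS a zero    = oneS
  powS a (suc k) = a ⋆ powS a k

  -- 1/(1+x) = Σ (-1)^n x^n  (the inverse of 1+x in R[[x]])
  inv1+x : PS
  inv1+x n = sgn n

  inv1+x² : PS
  inv1+x² = inv1+x ⋆ inv1+x

  gS : Carrier → PS
  gS y = (λ n → δ n 0 + (y * δ n 1 + y * δ n 2)) ⋆ inv1+x²

  fS : PS
  fS = X ⋆ inv1+x²

  riordan : PS → PS → ℕ → ℕ → Carrier
  riordan g f n k = (g ⋆ powS f k) n

  L : Carrier → ℕ → ℕ → Carrier
  L y = riordan (gS y) fS

  -- Since A is lower triangular, (A·M)_{n,j} = Σ_{k=0}^{n} A_{n,k} M_{k,j}.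
  -- (For lower unitriangular A such as L this determines M uniquely.)
  IsInverseOf : (ℕ → ℕ → Carrier) → (ℕ → ℕ → Carrier) → Set ℓ
  IsInverseOf M A = ∀ n j → sumTo n (λ k → A n k * M k j) ≈ δ n j

  hankelDet : (ℕ → Carrier) → ℕ → Carrier
  hankelDet μ n = det (suc n) (λ i j → μ (toℕ i Data.Nat.+ toℕ j))

module Submission where

-- Write L_k = g·f^k for the k-th column of L.  Multiplying by (1+x)² clears the
-- denominators: (1+x)² L_0 = 1 + y x + y x² and (1+x)² L_{k+1} = x L_k.  Reading off
-- coefficients, L is lower unitriangular and its entries obey the three-term rule
--   L_{n,k-1} = L_{n+1,k} + 2 L_{n,k} + β_n L_{n-1,k}   (β_1 = 1 - y, β_n = 1 for n ≥ 2),
-- i.e. L has a tridiagonal production matrix.  For ANY lower triangular array with such a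
-- rule and moments μ with Σ_k L_{j,k} μ_k = δ_{j,0}, the numbers E_{i,j} = Σ_k L_{j,k} μ_{k+i}
-- vanish for j > i and equal β_1⋯β_i for j = i (induction on i).  Hence L·H is
-- triangular, H = (μ_{i+j}) being the Hankel matrix; as L is unitriangular,
-- det H = det (L·H) = ∏_{i ≤ n} β_1⋯β_i = (1 - y)^n.

open import Defs
open import Data.Nat as ℕ using (ℕ; zero; suc; _∸_; _≤_; _<_; z≤n; s≤s)
import Data.Nat.Properties as ℕₚ
open import Data.Maybe using (nothing)
open import Relation.Binary.PropositionalEquality as ≡ using (_≡_)
open import Relation.Nullary using (yes; no; ¬_)
open import Data.Empty using (⊥-elim)
open import Data.Product using (_×_; _,_; proj₁; proj₂)
open import Data.Fin as Fin using (Fin; toℕ; punchIn)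
open import Algebra.Bundles using (CommutativeRing)
open import Tactic.RingSolver.Core.AlmostCommutativeRing using (fromCommutativeRing)
import Tactic.RingSolver.NonReflective as NonReflective
import Algebra.Solver.CommutativeMonoid as CommutativeMonoidSolver
import Relation.Binary.Reasoning.Setoid as SetoidReasoning

module Hankel {c ℓ} (R : CommutativeRing c ℓ) where
  open CommutativeRing R hiding (zero)
  open import Algebra.Properties.Ring ring using (-‿distribˡ-*; -‿distribʳ-*; -‿+-comm; ⁻¹-anti-homo‿-; -0#≈0#; -‿involutive; x[y-z]≈xy-xz)
  open SetoidReasoning setoid

  module Solver = NonReflective (fromCommutativeRing R (λ _ → nothing))
  open Solver using (solve; _⊕_; _⊗_; ⊝_; _⊜_)
  module ProductSolver = CommutativeMonoidSolver *-commutativeMonoid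
  open ProductSolver using () renaming (solve to solve*; _⊕_ to _⊛_; _⊜_ to _⊜*_)

  ≡⇒≈ : ∀ {a b} → a ≡ b → a ≈ b
  ≡⇒≈ ≡.refl = refl

  +-zeroʳ : ∀ {a z} → z ≈ 0# → a + z ≈ a
  +-zeroʳ {a} z≈0 = trans (+-congˡ z≈0) (+-identityʳ a)

  +-zeroˡ : ∀ {a z} → z ≈ 0# → z + a ≈ a
  +-zeroˡ {a} z≈0 = trans (+-congʳ z≈0) (+-identityˡ a)

  *-zeroʳ : ∀ {a z} → z ≈ 0# → a * z ≈ 0#
  *-zeroʳ {a} z≈0 = trans (*-congˡ z≈0) (zeroʳ a)

  *-zeroˡ : ∀ {a z} → z ≈ 0# → z * a ≈ 0#
  *-zeroˡ {a} z≈0 = trans (*-congʳ z≈0) (zeroˡ a)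

  Row : Set c
  Row = ℕ → Carrier

  module FiniteSums where
    Σ : ℕ → Row → Carrier
    Σ = sumTo R

    Σ-cong : ∀ n {f g} → (∀ i → f i ≈ g i) → Σ n f ≈ Σ n g
    Σ-cong zero    f≈g = f≈g 0
    Σ-cong (suc n) f≈g = +-cong (Σ-cong n f≈g) (f≈g (suc n))

    Σ-cong≤ : ∀ n {f g} → (∀ i → i ≤ n → f i ≈ g i) → Σ n f ≈ Σ n g
    Σ-cong≤ zero    f≈g = f≈g 0 z≤n
    Σ-cong≤ (suc n) f≈g =
      +-cong (Σ-cong≤ n (λ i i≤n → f≈g i (ℕₚ.m≤n⇒m≤1+n i≤n))) (f≈g (suc n) ℕₚ.≤-refl)

    Σ-zero : ∀ n {f} → (∀ i → f i ≈ 0#) → Σ n f ≈ 0#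
    Σ-zero zero    f≈0 = f≈0 0
    Σ-zero (suc n) f≈0 = trans (+-cong (Σ-zero n f≈0) (f≈0 (suc n))) (+-identityˡ 0#)

    Σ-+ : ∀ n f g → Σ n (λ i → f i + g i) ≈ Σ n f + Σ n g
    Σ-+ zero    f g = refl
    Σ-+ (suc n) f g = begin
      Σ n (λ i → f i + g i) + (f (suc n) + g (suc n)) ≈⟨ +-congʳ (Σ-+ n f g) ⟩
      (Σ n f + Σ n g) + (f (suc n) + g (suc n))       ≈⟨ interchange _ _ _ _ ⟩
      (Σ n f + f (suc n)) + (Σ n g + g (suc n))       ∎
      where
      interchange : ∀ a b p q → (a + b) + (p + q) ≈ (a + p) + (b + q)
      interchange = solve 4 (λ a b p q → ((a ⊕ b) ⊕ (p ⊕ q)) ⊜ ((a ⊕ p) ⊕ (b ⊕ q))) refl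

    Σ-neg : ∀ n f → Σ n (λ i → - f i) ≈ - Σ n f
    Σ-neg zero    f = refl
    Σ-neg (suc n) f = trans (+-congʳ (Σ-neg n f)) (-‿+-comm (Σ n f) (f (suc n)))

    Σ-− : ∀ n f g → Σ n (λ i → f i - g i) ≈ Σ n f - Σ n g
    Σ-− n f g = trans (Σ-+ n f (λ i → - g i)) (+-congˡ (Σ-neg n g))

    Σ-*ˡ : ∀ n a f → Σ n (λ i → a * f i) ≈ a * Σ n f
    Σ-*ˡ zero    a f = refl
    Σ-*ˡ (suc n) a f = trans (+-congʳ (Σ-*ˡ n a f)) (sym (distribˡ a (Σ n f) (f (suc n))))

    Σ-head : ∀ n f → Σ (suc n) f ≈ f 0 + Σ n (λ i → f (suc i))
    Σ-head zero    f = refl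
    Σ-head (suc n) f = trans (+-congʳ (Σ-head n f)) (+-assoc _ _ _)

    Σ-reverse : ∀ n f → Σ n f ≈ Σ n (λ i → f (n ∸ i))
    Σ-reverse zero    f = refl
    Σ-reverse (suc n) f = begin
      Σ n f + f (suc n)                  ≈⟨ +-congʳ (Σ-reverse n f) ⟩
      Σ n (λ i → f (n ∸ i)) + f (suc n)  ≈⟨ +-comm _ _ ⟩
      f (suc n) + Σ n (λ i → f (n ∸ i))  ≈⟨ Σ-head n (λ i → f (suc n ∸ i)) ⟨
      Σ (suc n) (λ i → f (suc n ∸ i))    ∎

    Σ-swap : ∀ n m (F : ℕ → ℕ → Carrier) →
             Σ n (λ i → Σ m (λ j → F i j)) ≈ Σ m (λ j → Σ n (λ i → F i j))
    Σ-swap zero    m F = refl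
    Σ-swap (suc n) m F = trans (+-congʳ (Σ-swap n m F)) (sym (Σ-+ m _ _))

    ∏ : ℕ → Row → Carrier
    ∏ zero    d = 1#
    ∏ (suc n) d = d 0 * ∏ n (λ i → d (suc i))

    ∏-cong : ∀ n {d e} → (∀ i → d i ≈ e i) → ∏ n d ≈ ∏ n e
    ∏-cong zero    d≈e = refl
    ∏-cong (suc n) d≈e = *-cong (d≈e 0) (∏-cong n (λ i → d≈e (suc i)))

    ∏-const : ∀ n x → ∏ n (λ _ → x) ≈ pow R x n
    ∏-const zero    x = refl
    ∏-const (suc n) x = *-congˡ (∏-const n x)

  module PowerSeries where
    open FiniteSums

    infixl 7 _⋆'_
    _⋆'_ : PS R → PS R → PS R
    _⋆'_ = _⋆_ R

    infix 4 _≐_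
    _≐_ : PS R → PS R → Set ℓ
    a ≐ b = ∀ n → a n ≈ b n

    shift : PS R → PS R
    shift a zero    = 0#
    shift a (suc n) = a n

    mul1+x : PS R → PS R
    mul1+x a zero    = a zero
    mul1+x a (suc n) = a (suc n) + a n

    mul[1+x]² : PS R → PS R
    mul[1+x]² a = mul1+x (mul1+x a)

    mul1+x-cong : ∀ {a b} → a ≐ b → mul1+x a ≐ mul1+x b
    mul1+x-cong a≐b zero    = a≐b zero
    mul1+x-cong a≐b (suc n) = +-cong (a≐b (suc n)) (a≐b n)

    mul1+x≐a+xa : ∀ a → mul1+x a ≐ (λ n → a n + shift a n)
    mul1+x≐a+xa a zero    = sym (+-identityʳ (a zero))
    mul1+x≐a+xa a (suc n) = refl

    ⋆-congˡ : ∀ {a a'} b → a ≐ a' → a ⋆' b ≐ a' ⋆' b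
    ⋆-congˡ b a≐a' n = Σ-cong n (λ i → *-congʳ (a≐a' i))

    ⋆-congʳ : ∀ a {b b'} → b ≐ b' → a ⋆' b ≐ a ⋆' b'
    ⋆-congʳ a b≐b' n = Σ-cong n (λ i → *-congˡ (b≐b' (n ∸ i)))

    ⋆-comm : ∀ a b → a ⋆' b ≐ b ⋆' a
    ⋆-comm a b n = begin
      Σ n (λ i → a i * b (n ∸ i))               ≈⟨ Σ-reverse n _ ⟩
      Σ n (λ i → a (n ∸ i) * b (n ∸ (n ∸ i)))   ≈⟨ Σ-cong≤ n (λ i i≤n → flip i i≤n) ⟩
      Σ n (λ i → b i * a (n ∸ i))               ∎
      where
      flip : ∀ i → i ≤ n → a (n ∸ i) * b (n ∸ (n ∸ i)) ≈ b i * a (n ∸ i)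
      flip i i≤n = trans (*-congˡ (≡⇒≈ (≡.cong b (ℕₚ.m∸[m∸n]≡n i≤n)))) (*-comm _ _)

    ⋆-identityˡ : ∀ a → oneS R ⋆' a ≐ a
    ⋆-identityˡ a zero    = *-identityˡ (a 0)
    ⋆-identityˡ a (suc n) = begin
      (oneS R ⋆' a) (suc n)                          ≈⟨ Σ-head n _ ⟩
      1# * a (suc n) + Σ n (λ i → 0# * a (n ∸ i))   ≈⟨ +-zeroʳ (Σ-zero n (λ i → zeroˡ _)) ⟩
      1# * a (suc n)                                 ≈⟨ *-identityˡ _ ⟩
      a (suc n)                                      ∎

    ⋆-identityʳ : ∀ a → a ⋆' oneS R ≐ a
    ⋆-identityʳ a n = trans (⋆-comm a (oneS R) n) (⋆-identityˡ a n)

    X⋆ : ∀ a → X R ⋆' a ≐ shift a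
    X⋆ a zero    = zeroˡ (a 0)
    X⋆ a (suc n) = trans (Σ-head n _) (trans (+-zeroˡ (zeroˡ _)) (⋆-identityˡ a n))

    ⋆-shift : ∀ a b → a ⋆' shift b ≐ shift (a ⋆' b)
    ⋆-shift a b zero    = zeroʳ (a 0)
    ⋆-shift a b (suc n) = begin
      Σ n (λ i → a i * shift b (suc n ∸ i)) + a (suc n) * shift b (n ∸ n)
        ≈⟨ +-zeroʳ (*-zeroʳ (≡⇒≈ (≡.cong (shift b) (ℕₚ.n∸n≡0 n)))) ⟩
      Σ n (λ i → a i * shift b (suc n ∸ i))
        ≈⟨ Σ-cong≤ n (λ i i≤n → *-congˡ (≡⇒≈ (≡.cong (shift b) (ℕₚ.+-∸-assoc 1 i≤n)))) ⟩
      (a ⋆' b) n ∎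

    ⋆-distribˡ : ∀ a b b' → a ⋆' (λ k → b k + b' k) ≐ (λ n → (a ⋆' b) n + (a ⋆' b') n)
    ⋆-distribˡ a b b' n = trans (Σ-cong n (λ i → distribˡ (a i) _ _)) (Σ-+ n _ _)

    ⋆-mul1+xʳ : ∀ a b → a ⋆' mul1+x b ≐ mul1+x (a ⋆' b)
    ⋆-mul1+xʳ a b n = begin
      (a ⋆' mul1+x b) n                    ≈⟨ ⋆-congʳ a (mul1+x≐a+xa b) n ⟩
      (a ⋆' (λ k → b k + shift b k)) n     ≈⟨ ⋆-distribˡ a b (shift b) n ⟩
      (a ⋆' b) n + (a ⋆' shift b) n        ≈⟨ +-congˡ (⋆-shift a b n) ⟩
      (a ⋆' b) n + shift (a ⋆' b) n        ≈⟨ mul1+x≐a+xa (a ⋆' b) n ⟨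
      mul1+x (a ⋆' b) n                    ∎

    ⋆-mul1+xˡ : ∀ a b → mul1+x a ⋆' b ≐ mul1+x (a ⋆' b)
    ⋆-mul1+xˡ a b n = begin
      (mul1+x a ⋆' b) n    ≈⟨ ⋆-comm (mul1+x a) b n ⟩
      (b ⋆' mul1+x a) n    ≈⟨ ⋆-mul1+xʳ b a n ⟩
      mul1+x (b ⋆' a) n    ≈⟨ mul1+x-cong (⋆-comm b a) n ⟩
      mul1+x (a ⋆' b) n    ∎

    mul[1+x]²-cong : ∀ {a b} → a ≐ b → mul[1+x]² a ≐ mul[1+x]² b
    mul[1+x]²-cong a≐b = mul1+x-cong (mul1+x-cong a≐b)

    ⋆-mul[1+x]²ʳ : ∀ a b → a ⋆' mul[1+x]² b ≐ mul[1+x]² (a ⋆' b)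
    ⋆-mul[1+x]²ʳ a b n = trans (⋆-mul1+xʳ a (mul1+x b) n) (mul1+x-cong (⋆-mul1+xʳ a b) n)

    ⋆-mul[1+x]²ˡ : ∀ a b → mul[1+x]² a ⋆' b ≐ mul[1+x]² (a ⋆' b)
    ⋆-mul[1+x]²ˡ a b n = trans (⋆-mul1+xˡ (mul1+x a) b n) (mul1+x-cong (⋆-mul1+xˡ a b) n)

    mul1+x-inv : mul1+x (inv1+x R) ≐ oneS R
    mul1+x-inv zero    = refl
    mul1+x-inv (suc n) = -‿inverseˡ (sgn R n)

    mul[1+x]²-inv : mul[1+x]² (inv1+x² R) ≐ oneS R
    mul[1+x]²-inv n = begin
      mul1+x (mul1+x (inv1+x R ⋆' inv1+x R)) n  ≈⟨ mul1+x-cong (λ k → ⋆-mul1+xʳ (inv1+x R) (inv1+x R) k) n ⟨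
      mul1+x (inv1+x R ⋆' mul1+x (inv1+x R)) n  ≈⟨ mul1+x-cong (λ k → ⋆-congʳ (inv1+x R) mul1+x-inv k) n ⟩
      mul1+x (inv1+x R ⋆' oneS R) n             ≈⟨ mul1+x-cong (⋆-identityʳ (inv1+x R)) n ⟩
      mul1+x (inv1+x R) n                       ≈⟨ mul1+x-inv n ⟩
      oneS R n                                  ∎

    mul[1+x]²-cancel : ∀ b → mul[1+x]² (b ⋆' inv1+x² R) ≐ b
    mul[1+x]²-cancel b n = begin
      mul[1+x]² (b ⋆' inv1+x² R) n   ≈⟨ ⋆-mul[1+x]²ʳ b (inv1+x² R) n ⟨
      (b ⋆' mul[1+x]² (inv1+x² R)) n ≈⟨ ⋆-congʳ b mul[1+x]²-inv n ⟩
      (b ⋆' oneS R) n               ≈⟨ ⋆-identityʳ b n ⟩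
      b n                           ∎

    -- The coefficient of x^(n+2) in (1+x)² a is (a_{n+2} + a_{n+1}) + (a_{n+1} + a_n);
    -- when the lower coefficients vanish it reduces to a_{n+2}.
    private
      peel : ∀ {a z₁ z₂ z₃ w} → z₁ ≈ 0# → z₂ ≈ 0# → z₃ ≈ 0# → (a + z₁) + (z₂ + z₃) ≈ w → a ≈ w
      peel {a} z₁≈0 z₂≈0 z₃≈0 e =
        trans (sym (trans (+-cong (+-zeroʳ z₁≈0) (trans (+-cong z₂≈0 z₃≈0) (+-identityˡ 0#))) (+-identityʳ a))) e

    cleared-vanish : ∀ {a b} m → mul[1+x]² a ≐ shift b → (∀ n → n < m → b n ≈ 0#) →
                     ∀ n → n < suc m → a n ≈ 0#
    cleared-vanish m e b≈0 zero _ = e zero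
    cleared-vanish zero e b≈0 (suc _) (s≤s ())
    cleared-vanish (suc m) e b≈0 (suc zero) _ =
      peel {z₂ = 0#} a₀≈0 refl a₀≈0 (trans (+-congˡ (+-identityˡ _)) (trans (e 1) (b≈0 0 (s≤s z≤n))))
      where a₀≈0 = cleared-vanish (suc m) e b≈0 zero (s≤s z≤n)
    cleared-vanish (suc m) e b≈0 (suc (suc n)) (s≤s n+1<m+1) =
      peel (IH (suc n) (ℕₚ.m<n⇒m<1+n n+1<m+1)) (IH (suc n) (ℕₚ.m<n⇒m<1+n n+1<m+1))
           (IH n (ℕₚ.m<n⇒m<1+n (ℕₚ.m<n⇒m<1+n (ℕₚ.≤-pred n+1<m+1))))
           (trans (e (suc (suc n))) (b≈0 (suc n) n+1<m+1))
      where IH = cleared-vanish (suc m) e b≈0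

    cleared-leading : ∀ {a b} m → mul[1+x]² a ≐ shift b → (∀ n → n < suc m → a n ≈ 0#) →
                      a (suc m) ≈ b m
    cleared-leading zero e a≈0 =
      peel {z₂ = 0#} (a≈0 0 (s≤s z≤n)) refl (a≈0 0 (s≤s z≤n)) (trans (+-congˡ (+-identityˡ _)) (e 1))
    cleared-leading (suc m) e a≈0 =
      peel (a≈0 (suc m) ℕₚ.≤-refl) (a≈0 (suc m) ℕₚ.≤-refl) (a≈0 m (ℕₚ.m<n⇒m<1+n ℕₚ.≤-refl))
           (e (suc (suc m)))

  module RiordanArray (y : Carrier) where
    open PowerSeries

    numerator : PS R
    numerator n = δ R n 0 + (y * δ R n 1 + y * δ R n 2)

    numerator-high : ∀ n → numerator (3 ℕ.+ n) ≈ 0#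
    numerator-high n = trans (+-identityˡ _) (trans (+-cong (zeroʳ y) (zeroʳ y)) (+-identityˡ 0#))

    -- col k n = L_{n,k}, the coefficient of x^n in g f^k.
    col : ℕ → PS R
    col k = gS R y ⋆' powS R (fS R) k

    col₀-cleared : mul[1+x]² (col 0) ≐ numerator
    col₀-cleared n = trans (mul[1+x]²-cong (⋆-identityʳ (gS R y)) n) (mul[1+x]²-cancel numerator n)

    f-cleared : mul[1+x]² (fS R) ≐ X R
    f-cleared = mul[1+x]²-cancel (X R)

    col-cleared : ∀ m → mul[1+x]² (col (suc m)) ≐ shift (col m)
    col-cleared m n = begin
      mul[1+x]² (g ⋆' (fS R ⋆' F)) n    ≈⟨ ⋆-mul[1+x]²ʳ g (fS R ⋆' F) n ⟨
      (g ⋆' mul[1+x]² (fS R ⋆' F)) n    ≈⟨ ⋆-congʳ g (⋆-mul[1+x]²ˡ (fS R) F) n ⟨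
      (g ⋆' (mul[1+x]² (fS R) ⋆' F)) n  ≈⟨ ⋆-congʳ g (⋆-congˡ F f-cleared) n ⟩
      (g ⋆' (X R ⋆' F)) n               ≈⟨ ⋆-congʳ g (X⋆ F) n ⟩
      (g ⋆' shift F) n                  ≈⟨ ⋆-shift g F n ⟩
      shift (col m) n                   ∎
      where
      g = gS R y
      F = powS R (fS R) m

    col-vanish : ∀ k n → n < k → col k n ≈ 0#
    col-vanish (suc m) n n<k = cleared-vanish m (col-cleared m) (col-vanish m) n n<k

    col-diag : ∀ k → col k k ≈ 1#
    col-diag zero    = trans (col₀-cleared 0) (+-zeroʳ (trans (+-cong (zeroʳ y) (zeroʳ y)) (+-identityˡ 0#)))
    col-diag (suc m) = trans (cleared-leading m (col-cleared m) (col-vanish (suc m))) (col-diag m)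

    -- Coefficients of the tridiagonal production matrix.
    β : ℕ → Carrier
    β (suc zero) = 1# - y
    β _          = 1#

    -- L_{j+2,k} + 2 L_{j+1,k} + β_{j+1} L_{j,k} = L_{j+1,k-1}  (read as 0 for k = 0).
    col-recurrence : ∀ j k → (col k (suc (suc j)) + col k (suc j)) + (col k (suc j) + β (suc j) * col k j)
                             ≈ shift (λ i → col i (suc j)) k
    col-recurrence (suc j) k =
      trans (+-congˡ (+-congˡ (*-identityˡ _))) (cleared-step k)
      where
      cleared-step : ∀ k → mul[1+x]² (col k) (3 ℕ.+ j) ≈ shift (λ i → col i (2 ℕ.+ j)) k
      cleared-step zero    = trans (col₀-cleared (3 ℕ.+ j)) (numerator-high j)
      cleared-step (suc m) = col-cleared m (3 ℕ.+ j)
    col-recurrence zero (suc m) =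
      trans (+-congˡ (+-congˡ (trans (*-zeroʳ a₀≈0) (sym a₀≈0)))) (col-cleared m 2)
      where a₀≈0 = col-vanish (suc m) 0 (s≤s z≤n)
    -- Row 1 of column 0: here β_1 = 1 - y absorbs the coefficient y of x² in the numerator.
    col-recurrence zero zero = begin
      (a₂ + a₁) + (a₁ + (1# - y) * a₀)     ≈⟨ regroup a₂ a₁ a₀ 1# y ⟩
      ((a₂ + a₁) + (a₁ + 1# * a₀)) + - y * a₀ ≈⟨ +-cong (+-congˡ (+-congˡ (*-identityˡ a₀))) (trans (sym (-‿distribˡ-* y a₀)) (-‿cong (*-congˡ (col-diag 0)))) ⟩
      ((a₂ + a₁) + (a₁ + a₀)) - y * 1#      ≈⟨ +-congʳ (col₀-cleared 2) ⟩
      (0# + (y * 0# + y * 1#)) - y * 1#     ≈⟨ +-congʳ (trans (+-identityˡ _) (+-zeroˡ (zeroʳ y))) ⟩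
      y * 1# - y * 1#                       ≈⟨ -‿inverseʳ (y * 1#) ⟩
      0#                                    ∎
      where
      a₀ = col 0 0
      a₁ = col 0 1
      a₂ = col 0 2
      regroup : ∀ a₂ a₁ a₀ o y → (a₂ + a₁) + (a₁ + (o - y) * a₀) ≈ ((a₂ + a₁) + (a₁ + o * a₀)) + - y * a₀
      regroup = solve 5 (λ a₂ a₁ a₀ o y →
        ((a₂ ⊕ a₁) ⊕ (a₁ ⊕ ((o ⊕ (⊝ y)) ⊗ a₀))) ⊜ (((a₂ ⊕ a₁) ⊕ (a₁ ⊕ (o ⊗ a₀))) ⊕ ((⊝ y) ⊗ a₀))) refl

  module ThreeTermMoments
      (col : ℕ → Row)                -- col k n = A_{n,k}
      (β : Row)
      (col-vanish : ∀ k n → n < k → col k n ≈ 0#)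
      (col-recurrence : ∀ j k → (col k (suc (suc j)) + col k (suc j)) + (col k (suc j) + β (suc j) * col k j)
                                ≈ PowerSeries.shift (λ i → col i (suc j)) k)
      (μ : Row)
      (orthogonal : ∀ j → sumTo R j (λ k → col k j * μ k) ≈ δ R j 0)
    where
    open FiniteSums
    open PowerSeries using (shift)

    -- E i j = Σ_k A_{j,k} μ_{k+i}, the (j,i) entry of A·H.
    E : ℕ → ℕ → Carrier
    E i j = Σ j (λ k → col k j * μ (k ℕ.+ i))

    βprod : ℕ → Carrier
    βprod zero    = 1#
    βprod (suc i) = β (suc i) * βprod i

    E₀ : ∀ j → E 0 j ≈ δ R j 0
    E₀ j = trans (Σ-cong j (λ k → *-congˡ (≡⇒≈ (≡.cong μ (ℕₚ.+-identityʳ k))))) (orthogonal j)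

    E-recurrence : ∀ i j → (E i (suc (suc j)) + E i (suc j)) + (E i (suc j) + β (suc j) * E i j)
                           ≈ E (suc i) (suc j)
    E-recurrence i j = begin
      (E i N₂ + E i N₁) + (E i N₁ + β N₁ * E i j)
        ≈⟨ +-cong (+-congˡ (sym B-extend)) (+-cong (sym B-extend) (*-congˡ (sym C-extend))) ⟩
      (Σ N₂ A + Σ N₂ B) + (Σ N₂ B + β N₁ * Σ N₂ C)
        ≈⟨ combine ⟨
      Σ N₂ (λ k → (A k + B k) + (B k + β N₁ * C k))
        ≈⟨ Σ-cong N₂ (λ k → trans (factor _ _ _ _ (f k)) (*-congʳ (col-recurrence j k))) ⟩
      Σ N₂ (λ k → shift (λ k' → col k' N₁) k * f k)
        ≈⟨ trans (Σ-head N₁ _) (+-zeroˡ (zeroˡ _)) ⟩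
      Σ N₁ (λ k → col k N₁ * μ (suc k ℕ.+ i))
        ≈⟨ Σ-cong N₁ (λ k → *-congˡ (≡⇒≈ (≡.cong μ (≡.sym (ℕₚ.+-suc k i))))) ⟩
      E (suc i) N₁ ∎
      where
      N₁ = suc j
      N₂ = suc (suc j)
      f A B C : Row
      f k = μ (k ℕ.+ i)
      A k = col k N₂ * f k
      B k = col k N₁ * f k
      C k = col k j * f k
      -- The shorter sums may be extended by terms lying above the diagonal.
      B-extend : Σ N₂ B ≈ E i N₁
      B-extend = +-zeroʳ (*-zeroˡ (col-vanish N₂ N₁ ℕₚ.≤-refl))
      C-extend : Σ N₂ C ≈ E i j
      C-extend = trans (+-zeroʳ (*-zeroˡ (col-vanish N₂ j (ℕₚ.m<n⇒m<1+n (ℕₚ.n<1+n j)))))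
                       (+-zeroʳ (*-zeroˡ (col-vanish N₁ j ℕₚ.≤-refl)))
      combine : Σ N₂ (λ k → (A k + B k) + (B k + β N₁ * C k)) ≈ (Σ N₂ A + Σ N₂ B) + (Σ N₂ B + β N₁ * Σ N₂ C)
      combine = trans (Σ-+ N₂ _ _) (+-cong (Σ-+ N₂ A B) (trans (Σ-+ N₂ B _) (+-congˡ (Σ-*ˡ N₂ (β N₁) C))))
      factor : ∀ a b c b' x → (a * x + b * x) + (b * x + b' * (c * x)) ≈ ((a + b) + (b + b' * c)) * x
      factor a b c b' x = begin
        (a * x + b * x) + (b * x + b' * (c * x)) ≈⟨ +-congˡ (+-congˡ (*-assoc b' c x)) ⟨
        (a * x + b * x) + (b * x + b' * c * x)   ≈⟨ +-cong (distribʳ x a b) (distribʳ x b (b' * c)) ⟨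
        (a + b) * x + (b + b' * c) * x           ≈⟨ distribʳ x (a + b) (b + b' * c) ⟨
        ((a + b) + (b + b' * c)) * x             ∎

    E-triangular : ∀ i → (∀ j → i < j → E i j ≈ 0#) × (E i i ≈ βprod i)
    E-triangular zero    = (λ { (suc j) _ → E₀ (suc j) }) , E₀ 0
    E-triangular (suc i) = above , diagonal
      where
      below-zero : ∀ j → i < j → E i j ≈ 0#
      below-zero = proj₁ (E-triangular i)
      drop-zeros : ∀ {a b x} → a ≈ 0# → b ≈ 0# → (a + b) + (b + x) ≈ x
      drop-zeros a≈0 b≈0 = trans (+-zeroˡ (trans (+-zeroʳ b≈0) a≈0)) (+-zeroˡ b≈0)
      above : ∀ j → suc i < j → E (suc i) j ≈ 0#
      above (suc j) (s≤s i<j) = begin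
        E (suc i) (suc j)
          ≈⟨ E-recurrence i j ⟨
        (E i (2 ℕ.+ j) + E i (suc j)) + (E i (suc j) + β (suc j) * E i j)
          ≈⟨ drop-zeros (below-zero _ (ℕₚ.m<n⇒m<1+n (ℕₚ.m<n⇒m<1+n i<j))) (below-zero _ (ℕₚ.m<n⇒m<1+n i<j)) ⟩
        β (suc j) * E i j
          ≈⟨ *-zeroʳ (below-zero j i<j) ⟩
        0# ∎
      diagonal : E (suc i) (suc i) ≈ βprod (suc i)
      diagonal = begin
        E (suc i) (suc i)
          ≈⟨ E-recurrence i i ⟨
        (E i (2 ℕ.+ i) + E i (suc i)) + (E i (suc i) + β (suc i) * E i i)
          ≈⟨ drop-zeros (below-zero _ (ℕₚ.m<n⇒m<1+n ℕₚ.≤-refl)) (below-zero _ ℕₚ.≤-refl) ⟩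
        β (suc i) * E i i
          ≈⟨ *-congˡ (proj₂ (E-triangular i)) ⟩
        βprod (suc i) ∎

  module Determinants where
    open FiniteSums

    Mat : Set c
    Mat = ℕ → ℕ → Carrier

    -- skip j s is the s-th natural number different from j (ℕ-version of punchIn).
    skip : ℕ → ℕ → ℕ
    skip zero    s       = suc s
    skip (suc j) zero    = zero
    skip (suc j) (suc s) = suc (skip j s)

    skip-below : ∀ {j k} → k < j → skip j k ≡ k
    skip-below {suc j} {zero}  _         = ≡.refl
    skip-below {suc j} {suc k} (s≤s k<j) = ≡.cong suc (skip-below k<j)

    skip-above : ∀ {j k} → j ≤ k → skip j k ≡ suc k
    skip-above {zero}          _         = ≡.refl
    skip-above {suc j} {suc k} (s≤s j≤k) = ≡.cong suc (skip-above j≤k)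

    skip-skip : ∀ {j k} → j ≤ k → ∀ s → skip j (skip k s) ≡ skip (suc k) (skip j s)
    skip-skip {zero}          _         s       = ≡.refl
    skip-skip {suc j} {suc k} (s≤s j≤k) zero    = ≡.refl
    skip-skip {suc j} {suc k} (s≤s j≤k) (suc s) = ≡.cong suc (skip-skip j≤k s)

    Σ-skip : ∀ m j g → j ≤ suc m → Σ m (λ k → g (skip j k)) + g j ≈ Σ (suc m) g
    Σ-skip m       zero          g _         = trans (+-comm _ _) (sym (Σ-head m g))
    Σ-skip zero    (suc zero)    g _         = refl
    Σ-skip zero    (suc (suc j)) g (s≤s ())
    Σ-skip (suc m) (suc j)       g (s≤s j≤m) = begin
      Σ (suc m) (λ k → g (skip (suc j) k)) + g (suc j)        ≈⟨ +-congʳ (Σ-head m _) ⟩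
      (g 0 + Σ m (λ k → g (suc (skip j k)))) + g (suc j)      ≈⟨ +-assoc _ _ _ ⟩
      g 0 + (Σ m (λ k → g (suc (skip j k))) + g (suc j))      ≈⟨ +-congˡ (Σ-skip m j (λ k → g (suc k)) j≤m) ⟩
      g 0 + Σ (suc m) (λ k → g (suc k))                       ≈⟨ Σ-head (suc m) g ⟨
      Σ (suc (suc m)) g                                       ∎

    -- det′ n A is the determinant of the n×n matrix (A i j)_{i,j<n};
    -- expand m v Y is the determinant of the (m+1)×(m+1) matrix with first row v
    -- and further rows Y 0, Y 1, …, expanded along the first row.
    det′ : ℕ → Mat → Carrier
    expand : ℕ → Row → Mat → Carrier
    det′ zero    A = 1#
    det′ (suc n) A = expand n (A 0) (λ r → A (suc r))
    expand m v Y = Σ m (λ j → sgn R j * (v j * det′ m (λ r s → Y r (skip j s))))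

    det′-cong : ∀ n {A B : Mat} → (∀ i j → A i j ≈ B i j) → det′ n A ≈ det′ n B
    expand-cong : ∀ m {v v' : Row} {Y Y' : Mat} → (∀ j → v j ≈ v' j) → (∀ r s → Y r s ≈ Y' r s) →
                  expand m v Y ≈ expand m v' Y'
    det′-cong zero    A≈B = refl
    det′-cong (suc n) A≈B = expand-cong n (A≈B 0) (λ r → A≈B (suc r))
    expand-cong m v≈v' Y≈Y' = Σ-cong m (λ j → *-congˡ (*-cong (v≈v' j) (det′-cong m (λ r s → Y≈Y' r (skip j s)))))

    -- Expansion along the first two rows u, w (further rows Y):
    -- definitionally  expand (suc m) u Z = expand₂ m u (Z 0) (λ r → Z (suc r)).
    expand₂ : ℕ → Row → Row → Mat → Carrier
    expand₂ m u w Y = Σ (suc m) (λ j → sgn R j * (u j * expand m (λ s → w (skip j s)) (λ r s → Y r (skip j s))))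

    expand₂-linear : ∀ m u u' a w Y →
                     expand₂ m (λ j → u j + a * u' j) w Y ≈ expand₂ m u w Y + a * expand₂ m u' w Y
    expand₂-linear m u u' a w Y =
      trans (Σ-cong (suc m) (λ j → distribute (sgn R j) (u j) (u' j) a _))
            (trans (Σ-+ (suc m) _ _) (+-congˡ (Σ-*ˡ (suc m) a _)))
      where
      distribute : ∀ s x x' a t → s * ((x + a * x') * t) ≈ s * (x * t) + a * (s * (x' * t))
      distribute s x x' a t = begin
        s * ((x + a * x') * t)         ≈⟨ *-congˡ (distribʳ t x (a * x')) ⟩
        s * (x * t + a * x' * t)       ≈⟨ distribˡ s (x * t) (a * x' * t) ⟩
        s * (x * t) + s * (a * x' * t) ≈⟨ +-congˡ (solve* 4 (λ s a x' t →
                                            (s ⊛ ((a ⊛ x') ⊛ t)) ⊜* (a ⊛ (s ⊛ (x' ⊛ t)))) refl s a x' t) ⟩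
        s * (x * t) + a * (s * (x' * t)) ∎

    below : ℕ → ℕ → Carrier
    below j c with c ℕ.<? j
    ... | yes _ = 1#
    ... | no  _ = 0#

    below-yes : ∀ {j c} → c < j → below j c ≈ 1#
    below-yes {j} {c} c<j with c ℕ.<? j
    ... | yes _   = refl
    ... | no  c≮j = ⊥-elim (c≮j c<j)

    below-no : ∀ {j c} → ¬ c < j → below j c ≈ 0#
    below-no {j} {c} c≮j with c ℕ.<? j
    ... | yes c<j = ⊥-elim (c≮j c<j)
    ... | no  _   = refl

    select-lt : ∀ {j c} x x' → c < j → below j c * x - below c j * x' ≈ x
    select-lt x x' c<j =
      trans (+-cong (trans (*-congʳ (below-yes c<j)) (*-identityˡ x))
                    (-‿cong (*-zeroˡ (below-no (ℕₚ.<-asym c<j)))))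
            (+-zeroʳ -0#≈0#)

    select-gt : ∀ {j c} x x' → j < c → below j c * x - below c j * x' ≈ - x'
    select-gt x x' j<c =
      trans (+-cong (*-zeroˡ (below-no (ℕₚ.<-asym j<c))) (-‿cong (trans (*-congʳ (below-yes j<c)) (*-identityˡ x'))))
            (+-identityˡ _)

    select-eq : ∀ j x x' → below j j * x - below j j * x' ≈ 0#
    select-eq j x x' = trans (+-cong (*-zeroˡ b≈0) (-‿cong (*-zeroˡ b≈0))) (trans (+-identityˡ _) -0#≈0#)
      where b≈0 = below-no {j} {j} (ℕₚ.<-irrefl ≡.refl)

    -- The determinant is alternating in its first two rows.
    module TwoRows (m : ℕ) (Y : Mat) where
      -- Y with the columns p < q deleted.
      minor₂ : ℕ → ℕ → Carrier
      minor₂ p q = det′ m (λ r s → Y r (skip q (skip p s)))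

      -- Column j taken from row u and column c < j from row w.
      pairTerm : Row → Row → ℕ → ℕ → Carrier
      pairTerm u w j c = below j c * ((sgn R j * sgn R c) * ((u j * w c) * minor₂ c j))

      pairSum : Row → Row → Carrier
      pairSum u w = Σ (suc m) (λ j → Σ (suc m) (λ c → pairTerm u w j c))

      -- The expansion of the minor at column j along the row w, indexed by the actual column c.
      secondRow : Row → ℕ → ℕ → Carrier
      secondRow w j c = sgn R c * (w c * (below j c * minor₂ c j - below c j * minor₂ j c))

      secondRow-skip : ∀ w j k → sgn R k * (w (skip j k) * det′ m (λ r s → Y r (skip j (skip k s))))
                                 ≈ secondRow w j (skip j k)
      secondRow-skip w j k with k ℕ.<? j
      ... | yes k<j rewrite skip-below k<j = *-congˡ (*-congˡ (sym (select-lt _ _ k<j)))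
      ... | no  k≮j rewrite skip-above (ℕₚ.≮⇒≥ k≮j) = begin
        sgn R k * (w (suc k) * det′ m (λ r s → Y r (skip j (skip k s))))
          ≈⟨ *-congˡ (*-congˡ (det′-cong m (λ r s → ≡⇒≈ (≡.cong (Y r) (skip-skip (ℕₚ.≮⇒≥ k≮j) s))))) ⟩
        sgn R k * (w (suc k) * minor₂ j (suc k))
          ≈⟨ double-negation (sgn R k) (w (suc k)) (minor₂ j (suc k)) ⟨
        - sgn R k * (w (suc k) * - minor₂ j (suc k))
          ≈⟨ *-congˡ (*-congˡ (select-gt _ _ (s≤s (ℕₚ.≮⇒≥ k≮j)))) ⟨
        secondRow w j (suc k) ∎
        where
        double-negation : ∀ a b t → - a * (b * - t) ≈ a * (b * t)
        double-negation a b t = begin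
          - a * (b * - t)   ≈⟨ *-congˡ (-‿distribʳ-* b t) ⟨
          - a * - (b * t)   ≈⟨ -‿distribʳ-* (- a) (b * t) ⟨
          - (- a * (b * t)) ≈⟨ -‿cong (-‿distribˡ-* a (b * t)) ⟨
          - - (a * (b * t)) ≈⟨ -‿involutive _ ⟩
          a * (b * t)       ∎

      expand-minor : ∀ w j → j ≤ suc m →
                     expand m (λ s → w (skip j s)) (λ r s → Y r (skip j s)) ≈ Σ (suc m) (secondRow w j)
      expand-minor w j j≤m+1 = begin
        expand m (λ s → w (skip j s)) (λ r s → Y r (skip j s)) ≈⟨ Σ-cong m (secondRow-skip w j) ⟩
        Σ m (λ k → secondRow w j (skip j k))                   ≈⟨ +-zeroʳ secondRow-diag ⟨
        Σ m (λ k → secondRow w j (skip j k)) + secondRow w j j ≈⟨ Σ-skip m j (secondRow w j) j≤m+1 ⟩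
        Σ (suc m) (secondRow w j)                              ∎
        where
        secondRow-diag : secondRow w j j ≈ 0#
        secondRow-diag = *-zeroʳ (*-zeroʳ (select-eq j _ _))

      expand₂-pairs : ∀ u w → expand₂ m u w Y ≈ pairSum u w - pairSum w u
      expand₂-pairs u w = begin
        expand₂ m u w Y
          ≈⟨ Σ-cong≤ (suc m) (λ j j≤ → *-congˡ (*-congˡ (expand-minor w j j≤))) ⟩
        Σ (suc m) (λ j → sgn R j * (u j * Σ (suc m) (secondRow w j)))
          ≈⟨ Σ-cong (suc m) distribute ⟩
        Σ (suc m) (λ j → Σ (suc m) (λ c → sgn R j * (u j * secondRow w j c)))
          ≈⟨ Σ-cong (suc m) (λ j → Σ-cong (suc m) (λ c →
               rearrange (sgn R j) (u j) (sgn R c) (w c) (below j c) (minor₂ c j) (below c j) (minor₂ j c))) ⟩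
        Σ (suc m) (λ j → Σ (suc m) (λ c → pairTerm u w j c - pairTerm w u c j))
          ≈⟨ trans (Σ-cong (suc m) (λ j → Σ-− (suc m) _ _)) (Σ-− (suc m) _ _) ⟩
        pairSum u w - Σ (suc m) (λ j → Σ (suc m) (λ c → pairTerm w u c j))
          ≈⟨ +-congˡ (-‿cong (Σ-swap (suc m) (suc m) _)) ⟩
        pairSum u w - pairSum w u ∎
        where
        distribute : ∀ j → sgn R j * (u j * Σ (suc m) (secondRow w j))
                           ≈ Σ (suc m) (λ c → sgn R j * (u j * secondRow w j c))
        distribute j = sym (trans (Σ-*ˡ (suc m) (sgn R j) _) (*-congˡ (Σ-*ˡ (suc m) (u j) _)))
        rearrange : ∀ sj uj sc wc p t q t' →
                    sj * (uj * (sc * (wc * (p * t - q * t'))))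
                    ≈ p * ((sj * sc) * ((uj * wc) * t)) - q * ((sc * sj) * ((wc * uj) * t'))
        rearrange sj uj sc wc p t q t' = begin
          sj * (uj * (sc * (wc * (p * t - q * t'))))
            ≈⟨ solve* 5 (λ sj uj sc wc d → (sj ⊛ (uj ⊛ (sc ⊛ (wc ⊛ d)))) ⊜* (((sj ⊛ sc) ⊛ (uj ⊛ wc)) ⊛ d))
                      refl sj uj sc wc (p * t - q * t') ⟩
          k * (p * t - q * t')
            ≈⟨ x[y-z]≈xy-xz k (p * t) (q * t') ⟩
          k * (p * t) - k * (q * t')
            ≈⟨ +-cong (solve* 6 (λ sj sc uj wc p t →
                         (((sj ⊛ sc) ⊛ (uj ⊛ wc)) ⊛ (p ⊛ t)) ⊜* (p ⊛ ((sj ⊛ sc) ⊛ ((uj ⊛ wc) ⊛ t)))) refl sj sc uj wc p t)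
                      (-‿cong (solve* 6 (λ sj sc uj wc q t' →
                         (((sj ⊛ sc) ⊛ (uj ⊛ wc)) ⊛ (q ⊛ t')) ⊜* (q ⊛ ((sc ⊛ sj) ⊛ ((wc ⊛ uj) ⊛ t')))) refl sj sc uj wc q t')) ⟩
          p * ((sj * sc) * ((uj * wc) * t)) - q * ((sc * sj) * ((wc * uj) * t')) ∎
          where k = (sj * sc) * (uj * wc)

      expand₂-swap : ∀ u w → expand₂ m u w Y ≈ - expand₂ m w u Y
      expand₂-swap u w = begin
        expand₂ m u w Y             ≈⟨ expand₂-pairs u w ⟩
        pairSum u w - pairSum w u   ≈⟨ ⁻¹-anti-homo‿- (pairSum w u) (pairSum u w) ⟨
        - (pairSum w u - pairSum u w) ≈⟨ -‿cong (expand₂-pairs w u) ⟨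
        - expand₂ m w u Y           ∎

      expand₂-equal : ∀ w → expand₂ m w w Y ≈ 0#
      expand₂-equal w = trans (expand₂-pairs w w) (-‿inverseʳ _)

    open TwoRows using (expand₂-swap; expand₂-equal)

    -- Induction: swap the first two rows, use the hypothesis on the
    -- minors, and drop the resulting determinant with two equal rows.
    expand-addFirstRow : ∀ m v (Y : Mat) (a : Row) → expand m v (λ r s → Y r s + a r * v s) ≈ expand m v Y
    expand-addFirstRow zero    v Y a = refl
    expand-addFirstRow (suc m) v Y a = begin
      expand₂ m v W₀ W                                 ≈⟨ expand₂-swap m W v W₀ ⟩
      - expand₂ m W₀ v W                               ≈⟨ -‿cong (Σ-cong (suc m) (λ j → *-congˡ (*-congˡ (minors j)))) ⟩
      - expand₂ m W₀ v Y'                              ≈⟨ -‿cong (expand₂-linear m (Y 0) v (a 0) v Y') ⟩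
      - (expand₂ m (Y 0) v Y' + a 0 * expand₂ m v v Y') ≈⟨ -‿cong (+-zeroʳ (*-zeroʳ (expand₂-equal m Y' v))) ⟩
      - expand₂ m (Y 0) v Y'                           ≈⟨ expand₂-swap m Y' v (Y 0) ⟨
      expand₂ m v (Y 0) Y'                             ∎
      where
      W₀ : Row
      W₀ s = Y 0 s + a 0 * v s
      W Y' : Mat
      W  r s = Y (suc r) s + a (suc r) * v s
      Y' r s = Y (suc r) s
      minors : ∀ j → expand m (λ s → v (skip j s)) (λ r s → W r (skip j s))
                     ≈ expand m (λ s → v (skip j s)) (λ r s → Y' r (skip j s))
      minors j = expand-addFirstRow m (λ s → v (skip j s)) (λ r s → Y' r (skip j s)) (λ r → a (suc r))

    -- Product with a lower triangular matrix T: only the entries T i k with k ≤ i are used.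
    _⊙_ : Mat → Mat → Mat
    (T ⊙ A) i j = Σ i (λ k → T i k * A k j)

    det′-unitriangular : ∀ n (T A : Mat) → (∀ i → T i i ≈ 1#) → det′ n (T ⊙ A) ≈ det′ n A
    det′-unitriangular zero    T A T-diag = refl
    det′-unitriangular (suc n) T A T-diag = begin
      expand n (λ j → T 0 0 * A 0 j) (λ r → (T ⊙ A) (suc r))
        ≈⟨ expand-cong n (λ j → trans (*-congʳ (T-diag 0)) (*-identityˡ _)) later-rows ⟩
      expand n (A 0) (λ r s → (T' ⊙ A') r s + a r * A 0 s)
        ≈⟨ expand-addFirstRow n (A 0) (T' ⊙ A') a ⟩
      expand n (A 0) (T' ⊙ A')
        ≈⟨ Σ-cong n (λ j → *-congˡ (*-congˡ (det′-unitriangular n T' (λ r s → A' r (skip j s)) (λ i → T-diag (suc i))))) ⟩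
      expand n (A 0) A' ∎
      where
      T' A' : Mat
      T' r k = T (suc r) (suc k)
      A' r = A (suc r)
      a : Row
      a r = T (suc r) 0
      later-rows : ∀ r s → (T ⊙ A) (suc r) s ≈ (T' ⊙ A') r s + a r * A 0 s
      later-rows r s = trans (Σ-head r _) (+-comm _ _)

    det′-zeroColumn : ∀ n (A : Mat) → (∀ r → A r 0 ≈ 0#) → det′ (suc n) A ≈ 0#
    det′-zeroColumn zero    A col≈0 = *-zeroʳ (*-zeroˡ (col≈0 0))
    det′-zeroColumn (suc n) A col≈0 =
      trans (Σ-head n _)
            (trans (+-zeroˡ (*-zeroʳ (*-zeroˡ (col≈0 0))))
                   (Σ-zero n (λ j → *-zeroʳ (*-zeroʳ (det′-zeroColumn n (λ r s → A (suc r) (skip (suc j) s)) (λ r → col≈0 (suc r)))))))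

    det′-triangular : ∀ n (U : Mat) → (∀ i j → j < i → U i j ≈ 0#) → det′ n U ≈ ∏ n (λ i → U i i)
    det′-triangular zero          U U-tri = refl
    det′-triangular (suc zero)    U U-tri = *-identityˡ _
    det′-triangular (suc (suc n)) U U-tri =
      trans (Σ-head n _)
        (trans (+-zeroʳ (Σ-zero n (λ j → *-zeroʳ (*-zeroʳ (det′-zeroColumn n (λ r s → U (suc r) (skip (suc j) s)) (λ r → U-tri (suc r) 0 (s≤s z≤n)))))))
        (trans (*-identityˡ _)
               (*-congˡ (det′-triangular (suc n) (λ r s → U (suc r) (suc s)) (λ i j j<i → U-tri (suc i) (suc j) (s≤s j<i))))))

    toℕ-punchIn : ∀ {n} (j : Fin (suc n)) (s : Fin n) → toℕ (punchIn j s) ≡ skip (toℕ j) (toℕ s)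
    toℕ-punchIn Fin.zero    s           = ≡.refl
    toℕ-punchIn (Fin.suc j) Fin.zero    = ≡.refl
    toℕ-punchIn (Fin.suc j) (Fin.suc s) = ≡.cong suc (toℕ-punchIn j s)

    sumFin-cong : ∀ n {f g : Fin n → Carrier} → (∀ i → f i ≈ g i) → sumFin R n f ≈ sumFin R n g
    sumFin-cong zero    f≈g = refl
    sumFin-cong (suc n) f≈g = +-cong (f≈g Fin.zero) (sumFin-cong n (λ i → f≈g (Fin.suc i)))

    sumFin≈Σ : ∀ n (f : Row) → sumFin R (suc n) (λ j → f (toℕ j)) ≈ Σ n f
    sumFin≈Σ zero    f = +-identityʳ _
    sumFin≈Σ (suc n) f = trans (+-congˡ (sumFin≈Σ n (λ i → f (suc i)))) (sym (Σ-head n f))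

    det≈det′ : ∀ n (B : Fin n → Fin n → Carrier) (A : Mat) → (∀ i j → B i j ≈ A (toℕ i) (toℕ j)) →
               det R n B ≈ det′ n A
    det≈det′ zero    B A B≈A = refl
    det≈det′ (suc n) B A B≈A =
      trans (sumFin-cong (suc n) (λ j → *-congˡ {sgn R (toℕ j)} (*-cong (B≈A Fin.zero j) (det≈det′ n _ (λ r s → A (suc r) (skip (toℕ j) s)) (minor j)))))
            (sumFin≈Σ n (λ j → sgn R j * (A 0 j * det′ n (λ r s → A (suc r) (skip j s)))))
      where
      minor : ∀ j r s → B (Fin.suc r) (punchIn j s) ≈ A (suc (toℕ r)) (skip (toℕ j) (toℕ s))
      minor j r s = trans (B≈A (Fin.suc r) (punchIn j s)) (≡⇒≈ (≡.cong (A (suc (toℕ r))) (toℕ-punchIn j s)))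

mainTheorem5 : ∀ {c ℓ} (R : CommutativeRing c ℓ) (y : CommutativeRing.Carrier R)
                 (M : ℕ → ℕ → CommutativeRing.Carrier R) →
                 IsInverseOf R M (L R y) →
                 ∀ (n : ℕ) → CommutativeRing._≈_ R (hankelDet R (λ m → M m 0) n)
                               (pow R (CommutativeRing._-_ R (CommutativeRing.1# R) y) n)
mainTheorem5 R y M inverse n = begin
  hankelDet R μ n               ≈⟨ det≈det′ (suc n) _ H (λ i j → refl) ⟩
  det′ (suc n) H                ≈⟨ det′-unitriangular (suc n) T H col-diag ⟨
  det′ (suc n) (T ⊙ H)          ≈⟨ det′-triangular (suc n) (T ⊙ H) (λ i j j<i → proj₁ (E-triangular j) i j<i) ⟩
  ∏ (suc n) (λ i → E i i)       ≈⟨ ∏-cong (suc n) (λ i → proj₂ (E-triangular i)) ⟩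
  ∏ (suc n) βprod               ≈⟨ trans (*-identityˡ _) (trans (∏-cong n βprod-suc) (∏-const n (1# - y))) ⟩
  pow R (1# - y) n              ∎
  where
  open CommutativeRing R
  open SetoidReasoning setoid
  open Hankel R
  open FiniteSums
  open Determinants
  open RiordanArray y
  μ : Row
  μ m = M m 0
  open ThreeTermMoments col β col-vanish col-recurrence μ (λ j → inverse j 0)
  H T : Mat
  H i j = μ (i ℕ.+ j)
  T i k = col k i
  -- β_1 = 1 - y and β_i = 1 for i ≥ 2, so every diagonal entry after the first is 1 - y.
  βprod-suc : ∀ i → βprod (suc i) ≈ 1# - y
  βprod-suc zero    = *-identityʳ _
  βprod-suc (suc i) = trans (*-identityˡ _) (βprod-suc i)
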